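{- Let $(G_x,\mathrm{lab}_x)=\rho_{i\to\{i,j\}}(G_y,\mathrm{lab}_y)$ for labels $i\neq j\in[k]$, and let $\mathcal{A}_y\subseteq\mathrm{aux}(G_y,\mathrm{lab}_y)$ satisfy $\mathcal{A}_y\lesssim\mathrm{aux}(G_y,\mathrm{lab}_y)$. Define $\mathcal{A}_x=\bigcup_{A\in\mathcal{A}_y}A^{i\to j}$. Then $\mathcal{A}_x\subseteq\mathrm{aux}(G_x,\mathrm{lab}_x)$ and $\mathcal{A}_x\lesssim\mathrm{aux}(G_x,\mathrm{lab}_x)$.
   Context: A multi-$k$-labeled graph is $(H,\mathrm{lab})$ with $\mathrm{lab}:V(H)\to2^{[k]}$. The operation $\rho_{i\to\{i,j\}}$ keeps the graph and adds label $j$ to the label set of every vertex whose label set contains $i$. A path packing of $H$ is a set of vertex-disjoint paths (possibly of length 0) in $H$ covering all vertices. A label choice of a path packing $\mathcal{P}$ is a map $\phi:\mathcal{P}\to\binom{[k]}{1}\cup\binom{[k]}{2}$ such that for each path $P$ with endpoints $u,v$ ($u=v$ iff $P$ has length 0), writing $\phi(P)=\{a,b\}$ (possibly $a=b$), we have $a\in\mathrm{lab}(u),b\in\mathrm{lab}(v)$ or $a\in\mathrm{lab}(v),b\in\mathrm{lab}(u)$. Multigraphs here have vertex set $[k]$, may have loops and parallel edges (each edge has an identifier); two multigraphs are equal if every pair $\{a,b\}$ (including $a=b$) has the same multiplicity. The auxiliary multigraph $\mathrm{aux}(\mathcal{P},\phi)$ has multiplicity of $\{a,b\}$ equal to $|\phi^{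 -1}(\{a,b\})|$; its edges are red. $\mathrm{aux}(H,\mathrm{lab})$ is the set of all $\mathrm{aux}(\mathcal{P},\phi)$. For a multigraph $A$, $A^{i\to j}$ is the family of all multigraphs obtained from $A$ by keeping every edge (same identifier) and, independently for every edge and each of its endpoints equal to $i$ (both endpoints separately for a loop at $i$), either keeping that endpoint $i$ or replacing it by $j$. $A\uplus B$ adds multiplicities. For a multigraph with red and blue edges and at least one edge, a red-blue Eulerian trail is a closed walk traversing every edge exactly once with alternating colors (first and last edges of different colors). For families $\mathcal{A},\mathcal{B}$ of red multigraphs, $\mathcal{A}\lesssim\mathcal{B}$ means: for every blue multigraph $M$ on $[k]$, if some $B\in\mathcal{B}$ makes $B\uplus M$ admit a red-blue Eulerian trail, then some $A\in\mathcal{A}$ makes $A\uplus M$ admit one. -}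

module Defs where

open import Data.Nat using (ℕ; zero; suc)
open import Data.Fin using (Fin)
open import Data.Fin.Properties using () renaming (_≟_ to _≟ᶠ_)
open import Data.Fin.Subset using (Subset; _∈_; _∪_; ⁅_⁆)
open import Data.Fin.Subset.Properties using (_∈?_)
open import Data.Bool using (Bool; true; false; if_then_else_)
open import Data.Product using (Σ; _×_; _,_; proj₁; proj₂; ∃)
open import Data.Sum using (_⊎_; inj₁; inj₂)
open import Data.Empty using (⊥)
open import Data.List using (lookup; List; []; _∷_; _++_; [_]; length; map; concatMap; filter; allFin)
open import Data.List.NonEmpty using (List⁺; _∷_; head; last; toList)
open import Data.List.Relation.Unary.Linked using (Linked)
open import Data.List.Relation.Binary.Pointwise using (Pointwise)
open import Data.List.Relation.Binary.Permutation.Propositional using (_↭_)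
open import Data.List.Relation.Unary.Unique.Propositional using (Unique)
import Data.List.Membership.Propositional as Mem
open import Relation.Binary.PropositionalEquality using (_≡_; _≢_)
open import Relation.Nullary using (¬_; Dec; yes; no)
open import Relation.Nullary.Decidable using (⌊_⌋; _⊎-dec_; _×-dec_)

record Graph (n : ℕ) : Set₁ where
  field
    Adj   : Fin n → Fin n → Set
    sym   : ∀ {u v} → Adj u v → Adj v u
    irrefl : ∀ {u} → ¬ Adj u u
open Graph public

Labeling : ℕ → ℕ → Set
Labeling n k = Fin n → Subset k

ρ : ∀ {n k} → Fin k → Fin k → Labeling n k → Labeling n k
ρ i j lab v = if ⌊ i ∈? lab v ⌋ then lab v ∪ ⁅ j ⁆ else lab v

-- a path: nonempty sequence of vertices, consecutive ones adjacent
-- (distinctness of vertices follows from the packing condition below)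
record Path {n} (G : Graph n) : Set where
  constructor mkPath
  field
    verts  : List⁺ (Fin n)
    linked : Linked (Adj G) (toList verts)
open Path public

first : ∀ {n} {G : Graph n} → Path G → Fin n
first P = head (verts P)

final : ∀ {n} {G : Graph n} → Path G → Fin n
final P = last (verts P)

-- vertex-disjoint paths covering all vertices: the concatenation of the
-- vertex sequences is a permutation of the vertex set
IsPathPacking : ∀ {n} {G : Graph n} → List (Path G) → Set
IsPathPacking {n} ps = concatMap (λ P → toList (verts P)) ps ↭ allFin n

-- Multigraphs on [k]: list of edges (the position is the identifier)

MG : ℕ → Set
MG k = List (Fin k × Fin k)

joins : ∀ {k} → Fin k → Fin k → Fin k × Fin k → Bool
joins a b (c , d) = ⌊ ((c ≟ᶠ a) ×-dec (d ≟ᶠ b)) ⊎-dec ((c ≟ᶠ b) ×-dec (d ≟ᶠ a)) ⌋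

mult : ∀ {k} → MG k → Fin k → Fin k → ℕ
mult [] a b = 0
mult (e ∷ es) a b = if joins a b e then suc (mult es a b) else mult es a b

_≈M_ : ∀ {k} → MG k → MG k → Set
A ≈M B = ∀ a b → mult A a b ≡ mult B a b

Fam : ℕ → Set₁
Fam k = MG k → Set

_⊆F_ : ∀ {k} → Fam k → Fam k → Set
𝒜 ⊆F ℬ = ∀ A → 𝒜 A → ℬ A

-- φ(P) = {a,b} with a ∈ lab(one endpoint), b ∈ lab(other endpoint);
-- stored as the ordered pair (a , b) with a at 'first', b at 'final'
ChoiceOk : ∀ {n k} {G : Graph n} → Labeling n k → Fin k × Fin k → Path G → Set
ChoiceOk lab (a , b) P = a ∈ lab (first P) × b ∈ lab (final P)

-- aux(H,lab) as a family (closed under multigraph equality)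
AuxFam : ∀ {n k} → Graph n → Labeling n k → Fam k
AuxFam G lab A =
  Σ (List (Path G)) λ ps → IsPathPacking ps ×
  Σ (MG _) λ φ → Pointwise (ChoiceOk lab) φ ps × (φ ≈M A)

Repl : ∀ {k} → Fin k → Fin k → Fin k → Fin k → Set
Repl i j u u' = (u' ≡ u) ⊎ ((u ≡ i) × (u' ≡ j))

InRepl : ∀ {k} → Fin k → Fin k → MG k → MG k → Set
InRepl i j A B =
  Pointwise (λ e e' → Repl i j (proj₁ e) (proj₁ e') × Repl i j (proj₂ e) (proj₂ e')) A B

liftFam : ∀ {k} → Fin k → Fin k → Fam k → Fam k
liftFam i j 𝒜 B = Σ (MG _) λ A → 𝒜 A × Σ (MG _) λ B' → InRepl i j A B' × (B' ≈M B)

data Color : Set where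
  red blue : Color

record Step {k} (R M : MG k) : Set where
  constructor step
  field
    ref     : Fin (length R) ⊎ Fin (length M)
    flipped : Bool
open Step public

edgeOf : ∀ {k} {R M : MG k} → Step R M → Fin k × Fin k
edgeOf {R = R} (step (inj₁ e) _) = lookup R e
edgeOf {M = M} (step (inj₂ e) _) = lookup M e

tailOf headOf : ∀ {k} {R M : MG k} → Step R M → Fin k
tailOf s@(step _ false) = proj₁ (edgeOf s)
tailOf s@(step _ true)  = proj₂ (edgeOf s)
headOf s@(step _ false) = proj₂ (edgeOf s)
headOf s@(step _ true)  = proj₁ (edgeOf s)

colorOf : ∀ {k} {R M : MG k} → Step R M → Color
colorOf (step (inj₁ _) _) = red
colorOf (step (inj₂ _) _) = blue

Next : ∀ {k} {R M : MG k} → Step R M → Step R M → Set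
Next s t = (headOf s ≡ tailOf t) × (colorOf s ≢ colorOf t)

ClosedWalk : ∀ {k} {R M : MG k} → List (Step R M) → Set
ClosedWalk [] = ⊥
ClosedWalk (s ∷ ss) = Linked Next ((s ∷ ss) ++ [ s ])

IsRBEulerianTrail : ∀ {k} (R M : MG k) → List (Step R M) → Set
IsRBEulerianTrail R M ss =
  ClosedWalk ss × Unique (map ref ss) × (∀ e → e Mem.∈ map ref ss)

HasRBEulerianTrail : ∀ {k} → MG k → MG k → Set
HasRBEulerianTrail R M = Σ (List (Step R M)) (IsRBEulerianTrail R M)

_≲_ : ∀ {k} → Fam k → Fam k → Set
_≲_ {k} 𝒜 ℬ = ∀ (M : MG k) →
  (Σ (MG k) λ B → ℬ B × HasRBEulerianTrail B M) →
  (Σ (MG k) λ A → 𝒜 A × HasRBEulerianTrail A M)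

-- A label choice for (G, lab) remains one for (G, ρ_{i→{i,j}} lab) after any endpoint label i
-- is replaced by j, and every choice for ρ_{i→{i,j}} lab arises this way from a choice for lab,
-- read backwards (j replaced by i). Equality of multigraphs only counts edges up to reversal, so
-- matching edges one at a time carries both facts over to auxiliary multigraphs: A ∈ aux(G_y)
-- gives A^{i→j} ⊆ aux(G_x), and each B ∈ aux(G_x) lies in B_y^{i→j} for some B_y ∈ aux(G_y).
--
-- If the red edges of a red-blue Eulerian trail are changed endpoint by endpoint, the trail
-- survives once every blue edge is reattached to the new ends of the red edges before and after
-- it. So a blue M completing B ∈ aux(G_x) becomes some M_y completing B_y; A_y ≲ aux(G_y) gives
-- A ∈ A_y completing M_y, and relabelling back, with M_y now red, turns A into some
-- A' ∈ A^{i→j} completing M.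

module Submission where

open import Defs hiding (sym)
open import Data.Nat using (ℕ; suc)
open import Data.Nat.Properties using (suc-injective)
open import Data.Fin using (Fin; cast)
open import Data.Fin.Properties using (cast-involutive)
open import Data.Fin.Subset using () renaming (_∈_ to _∈ₛ_)
open import Data.Fin.Subset.Properties using (_∈?_; p⊆p∪q; q⊆p∪q; x∈p∪q⁻; x∈⁅x⁆; x∈⁅y⁆⇒x≡y)
open import Data.Bool using (Bool; true; false)
open import Data.Bool.Properties using (T-≡)
open import Data.Product using (∃; ∃₂; _×_; _,_; proj₁; proj₂; uncurry)
import Data.Product as Product
open import Data.Sum using (_⊎_; inj₁; inj₂)
open import Data.Sum.Algebra using (⊎-comm)
open import Data.Sum.Function.Propositional using (_⊎-↔_)
open import Data.List using (List; []; _∷_; _++_; [_]; map; length; lookup; tabulate)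
open import Data.List.Properties
  using (map-++; map-∘; tabulate-lookup; length-tabulate; lookup-tabulate)
open import Data.List.Relation.Unary.All as All using (All; []; _∷_)
open import Data.List.Relation.Unary.AllPairs using (_∷_)
open import Data.List.Relation.Unary.Any using (Any; here; there)
open import Data.List.Relation.Unary.Linked as Linked using (Linked; [-]; _∷_)
import Data.List.Relation.Unary.Linked.Properties as Linked
open import Data.List.Relation.Unary.Unique.Propositional using (Unique)
import Data.List.Relation.Unary.Unique.Propositional.Properties as Unique
open import Data.List.Relation.Binary.Pointwise
  using (Pointwise; []; _∷_; ++⁺; Pointwise-length; lookup⁺; tabulate⁺; symmetric)
open import Data.List.Relation.Binary.Permutation.Propositional
  using (_↭_; prep; swap; ↭-sym; ↭⇒↭ₛ) renaming (refl to ↭-refl; trans to ↭-trans)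
open import Data.List.Relation.Binary.Permutation.Propositional.Properties
  using (shift; ∷↭∷ʳ; ∈-resp-↭)
open import Data.List.Relation.Binary.Permutation.Setoid.Properties using (Unique-resp-↭)
open import Data.List.Membership.Propositional using (_∈_; find)
open import Data.List.Membership.Propositional.Properties using (∈-∃++; ∈-map⁺; ∈-map⁻)
open import Function using (_∘_; _on_)
open import Function.Bundles using (Equivalence; Injection; Inverse; _↔_; mk↔ₛ′)
open import Function.Properties.Inverse using (↔⇒↣)
open import Relation.Binary.PropositionalEquality
  using (_≡_; _≢_; refl; sym; trans; cong; cong₂; subst; setoid; module ≡-Reasoning)
open import Relation.Nullary using (contradiction; yes; no)
open import Relation.Nullary.Decidable using (toWitness; fromWitness)

private variable
  k : ℕ
  A : Set
  a b : Fin k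

consecutive : A → List A → List (A × A)
consecutive x []       = []
consecutive x (y ∷ ys) = (x , y) ∷ consecutive y ys

module _ {_∼_ : A → A → Set} where

  Linked⇒All-consecutive : ∀ {x ys} → Linked _∼_ (x ∷ ys) → All (uncurry _∼_) (consecutive x ys)
  Linked⇒All-consecutive {ys = []}    [-]          = []
  Linked⇒All-consecutive {ys = _ ∷ _} (x∼y ∷ y∼ys) = x∼y ∷ Linked⇒All-consecutive y∼ys

  All-consecutive⇒Linked : ∀ {x} ys → All (uncurry _∼_) (consecutive x ys) → Linked _∼_ (x ∷ ys)
  All-consecutive⇒Linked []       []           = [-]
  All-consecutive⇒Linked (_ ∷ ys) (x∼y ∷ y∼ys) = x∼y ∷ All-consecutive⇒Linked ys y∼ys

map-proj₂-consecutive : ∀ (x : A) ys → map proj₂ (consecutive x ys) ≡ ys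
map-proj₂-consecutive x []       = refl
map-proj₂-consecutive x (y ∷ ys) = cong (y ∷_) (map-proj₂-consecutive y ys)

map-proj₁-consecutive : ∀ (x : A) ys z → map proj₁ (consecutive x (ys ++ [ z ])) ≡ x ∷ ys
map-proj₁-consecutive x []       z = refl
map-proj₁-consecutive x (y ∷ ys) z = cong (x ∷_) (map-proj₁-consecutive y ys z)

Unique-map⇒injective : ∀ {B : Set} (f : A → B) {xs x y} →
  Unique (map f xs) → x ∈ xs → y ∈ xs → f x ≡ f y → x ≡ y
Unique-map⇒injective f _         (here refl) (here refl) _  = refl
Unique-map⇒injective f (fx≢ ∷ _) (here refl) (there y∈)  eq = contradiction eq (All.lookup fx≢ (∈-map⁺ f y∈))
Unique-map⇒injective f (fy≢ ∷ _) (there x∈)  (here refl) eq = contradiction (sym eq) (All.lookup fy≢ (∈-map⁺ f x∈))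
Unique-map⇒injective f (_ ∷ u)   (there x∈)  (there y∈)  eq = Unique-map⇒injective f u x∈ y∈ eq

Unique-rotate : ∀ {A : Set} {x : A} xs → Unique (x ∷ xs) → Unique (xs ++ [ x ])
Unique-rotate {A} {x} xs = Unique-resp-↭ (setoid A) (↭⇒↭ₛ (∷↭∷ʳ x xs))

Pointwise-++⁻ˡ : ∀ {A B : Set} {_∼_ : A → B → Set} xs₁ {xs₂ ys} → Pointwise _∼_ (xs₁ ++ xs₂) ys →
  ∃₂ λ ys₁ ys₂ → ys ≡ ys₁ ++ ys₂ × Pointwise _∼_ xs₁ ys₁ × Pointwise _∼_ xs₂ ys₂
Pointwise-++⁻ˡ []        xs₂∼ys          = [] , _ , refl , [] , xs₂∼ys
Pointwise-++⁻ˡ (_ ∷ xs₁) (x∼y ∷ xs∼ys)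
  with ys₁ , ys₂ , refl , xs₁∼ys₁ , xs₂∼ys₂ ← Pointwise-++⁻ˡ xs₁ xs∼ys
  = _ ∷ ys₁ , ys₂ , refl , x∼y ∷ xs₁∼ys₁ , xs₂∼ys₂

-- Multiplicities of edges

Edge : ℕ → Set
Edge k = Fin k × Fin k

SameEnds : Edge k → Edge k → Set
SameEnds (a , b) (c , d) = (c ≡ a × d ≡ b) ⊎ (c ≡ b × d ≡ a)

SameEnds-refl : ∀ {e : Edge k} → SameEnds e e
SameEnds-refl = inj₁ (refl , refl)

SameEnds-sym : ∀ {e e' : Edge k} → SameEnds e e' → SameEnds e' e
SameEnds-sym (inj₁ (refl , refl)) = inj₁ (refl , refl)
SameEnds-sym (inj₂ (refl , refl)) = inj₂ (refl , refl)

SameEnds-trans : ∀ {e e' e'' : Edge k} → SameEnds e e' → SameEnds e' e'' → SameEnds e e''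
SameEnds-trans (inj₁ (refl , refl)) (inj₁ (refl , refl)) = inj₁ (refl , refl)
SameEnds-trans (inj₁ (refl , refl)) (inj₂ (refl , refl)) = inj₂ (refl , refl)
SameEnds-trans (inj₂ (refl , refl)) (inj₁ (refl , refl)) = inj₂ (refl , refl)
SameEnds-trans (inj₂ (refl , refl)) (inj₂ (refl , refl)) = inj₁ (refl , refl)

joins≡true : ∀ {e} → SameEnds (a , b) e → joins a b e ≡ true
joins≡true p = Equivalence.to T-≡ (fromWitness p)

joins≡true⇒SameEnds : ∀ {e} → joins a b e ≡ true → SameEnds (a , b) e
joins≡true⇒SameEnds eq = toWitness (Equivalence.from T-≡ eq)

joins-resp-SameEnds : ∀ {e e'} → SameEnds e e' → joins a b e ≡ joins a b e'
joins-resp-SameEnds {a = a} {b} {e} {e'} e∼e' with joins a b e in j | joins a b e' in j'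
... | true  | true  = refl
... | false | false = refl
... | true  | false
  with () ← trans (sym j') (joins≡true (SameEnds-trans (joins≡true⇒SameEnds j) e∼e'))
... | false | true
  with () ← trans (sym j) (joins≡true (SameEnds-trans (joins≡true⇒SameEnds j') (SameEnds-sym e∼e')))

-- _≈M_ unfolds to a Π-type, so Agda cannot infer the lists it relates: they are explicit below.

∷-cong-≈M : ∀ e (xs ys : MG k) → xs ≈M ys → (e ∷ xs) ≈M (e ∷ ys)
∷-cong-≈M e xs ys xs≈ys a b with joins a b e
... | true  = cong suc (xs≈ys a b)
... | false = xs≈ys a b

∷-cancel-≈M : ∀ e (xs ys : MG k) → (e ∷ xs) ≈M (e ∷ ys) → xs ≈M ys
∷-cancel-≈M e xs ys e∷xs≈e∷ys a b with joins a b e | e∷xs≈e∷ys a b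
... | true  | eq = suc-injective eq
... | false | eq = eq

SameEnds⇒∷-≈M : ∀ {e e'} (xs : MG k) → SameEnds e e' → (e ∷ xs) ≈M (e' ∷ xs)
SameEnds⇒∷-≈M xs e∼e' a b rewrite joins-resp-SameEnds {a = a} {b} e∼e' = refl

↭⇒≈M : {xs ys : MG k} → xs ↭ ys → xs ≈M ys
↭⇒≈M ↭-refl                 a b = refl
↭⇒≈M (prep {xs} {ys} e p)   a b = ∷-cong-≈M e xs ys (↭⇒≈M p) a b
↭⇒≈M (swap e e' p)          a b with joins a b e | joins a b e' | ↭⇒≈M p a b
... | true  | true  | eq = cong (suc ∘ suc) eq
... | true  | false | eq = cong suc eq
... | false | true  | eq = cong suc eq
... | false | false | eq = eq
↭⇒≈M (↭-trans p q)          a b = trans (↭⇒≈M p a b) (↭⇒≈M q a b)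

mult-∷-self : ∀ (e : Edge k) A → mult (e ∷ A) (proj₁ e) (proj₂ e) ≡ suc (mult A (proj₁ e) (proj₂ e))
mult-∷-self e A with joins (proj₁ e) (proj₂ e) e in j
... | true  = refl
... | false with () ← trans (sym j) (joins≡true {e = e} SameEnds-refl)

mult≡suc⇒Any : ∀ φ {n} → mult φ a b ≡ suc n → Any (SameEnds (a , b)) φ
mult≡suc⇒Any {a = a} {b} (e ∷ φ) eq with joins a b e in j
... | true  = here (joins≡true⇒SameEnds j)
... | false = there (mult≡suc⇒Any φ eq)

≈M-∷⇒split : ∀ (φ : MG k) e A → φ ≈M (e ∷ A) →
  ∃₂ λ φ₁ φ₂ → ∃ λ e' → φ ≡ φ₁ ++ e' ∷ φ₂ × SameEnds e e'
≈M-∷⇒split φ e A φ≈e∷A =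
  let e' , e'∈φ , e∼e' = find (mult≡suc⇒Any φ (trans (φ≈e∷A _ _) (mult-∷-self e A)))
      φ₁ , φ₂ , φ≡     = ∈-∃++ e'∈φ
  in  φ₁ , φ₂ , e' , φ≡ , e∼e'

≈M-remove : ∀ φ₁ φ₂ {e e'} (A : MG k) → SameEnds e e' → (φ₁ ++ e' ∷ φ₂) ≈M (e ∷ A) → (φ₁ ++ φ₂) ≈M A
≈M-remove φ₁ φ₂ {e} {e'} A e≃e' φ≈e∷A = ∷-cancel-≈M e (φ₁ ++ φ₂) A λ a b → begin
  mult (e ∷ φ₁ ++ φ₂) a b   ≡⟨ SameEnds⇒∷-≈M (φ₁ ++ φ₂) e≃e' a b ⟩
  mult (e' ∷ φ₁ ++ φ₂) a b  ≡⟨ ↭⇒≈M (shift e' φ₁ φ₂) a b ⟨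
  mult (φ₁ ++ e' ∷ φ₂) a b  ≡⟨ φ≈e∷A a b ⟩
  mult (e ∷ A) a b          ∎
  where open ≡-Reasoning

≈M-insert : ∀ ψ₁ ψ₂ {f f'} (B : MG k) → SameEnds f f' → (ψ₁ ++ ψ₂) ≈M B → (ψ₁ ++ f' ∷ ψ₂) ≈M (f ∷ B)
≈M-insert ψ₁ ψ₂ {f} {f'} B f≃f' ψ≈B a b = begin
  mult (ψ₁ ++ f' ∷ ψ₂) a b  ≡⟨ ↭⇒≈M (shift f' ψ₁ ψ₂) a b ⟩
  mult (f' ∷ ψ₁ ++ ψ₂) a b  ≡⟨ SameEnds⇒∷-≈M (ψ₁ ++ ψ₂) f≃f' a b ⟨
  mult (f ∷ ψ₁ ++ ψ₂) a b   ≡⟨ ∷-cong-≈M f (ψ₁ ++ ψ₂) B ψ≈B a b ⟩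
  mult (f ∷ B) a b          ∎
  where open ≡-Reasoning

Endwise : (Fin k → Fin k → Set) → Edge k → Edge k → Set
Endwise _∼_ e f = (proj₁ e ∼ proj₁ f) × (proj₂ e ∼ proj₂ f)

Endwise-SameEnds : ∀ {_∼_ : Fin k → Fin k → Set} {e e' f} → SameEnds e e' → Endwise _∼_ e f →
  ∃ λ f' → SameEnds f f' × Endwise _∼_ e' f'
Endwise-SameEnds (inj₁ (refl , refl)) e∼f        = _ , SameEnds-refl , e∼f
Endwise-SameEnds (inj₂ (refl , refl)) (a∼x , b∼y) = _ , inj₂ (refl , refl) , (b∼y , a∼x)

≈M-transport : ∀ {_∼_ : Fin k → Fin k → Set} (φ : MG k) {A B} →
  φ ≈M A → Pointwise (Endwise _∼_) A B → ∃ λ φ' → Pointwise (Endwise _∼_) φ φ' × φ' ≈M B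
≈M-transport []      φ≈[] [] = [] , [] , λ _ _ → refl
≈M-transport (e ∷ φ) φ≈[] [] with () ← trans (sym (mult-∷-self e φ)) (φ≈[] _ _)
≈M-transport φ {e ∷ A} {f ∷ B} φ≈e∷A (e∼f ∷ A∼B)
  with φ₁ , φ₂ , e' , refl , e≃e' ← ≈M-∷⇒split φ e A φ≈e∷A
  with ψ , φ₁₂∼ψ , ψ≈B ← ≈M-transport (φ₁ ++ φ₂) (≈M-remove φ₁ φ₂ A e≃e' φ≈e∷A) A∼B
  with ψ₁ , ψ₂ , refl , φ₁∼ψ₁ , φ₂∼ψ₂ ← Pointwise-++⁻ˡ φ₁ φ₁₂∼ψ
  with f' , f≃f' , e'∼f' ← Endwise-SameEnds e≃e' e∼f
  = ψ₁ ++ f' ∷ ψ₂ , ++⁺ φ₁∼ψ₁ (e'∼f' ∷ φ₂∼ψ₂) , ≈M-insert ψ₁ ψ₂ B f≃f' ψ≈B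

-- Auxiliary multigraphs under ρ

module _ {n} {lab : Labeling n k} {i j : Fin k} where

  ∈-ρ⁺ : ∀ {u u' v} → Repl i j u u' → u ∈ₛ lab v → u' ∈ₛ ρ i j lab v
  ∈-ρ⁺ {v = v} u↦u' u∈ with i ∈? lab v
  ∈-ρ⁺ (inj₁ refl)          u∈ | yes _  = p⊆p∪q _ u∈
  ∈-ρ⁺ (inj₂ (refl , refl)) u∈ | yes _  = q⊆p∪q _ _ (x∈⁅x⁆ _)
  ∈-ρ⁺ (inj₁ refl)          u∈ | no _   = u∈
  ∈-ρ⁺ (inj₂ (refl , refl)) i∈ | no i∉  = contradiction i∈ i∉

  ∈-ρ⁻ : ∀ {u v} → u ∈ₛ ρ i j lab v → ∃ λ u' → Repl j i u u' × u' ∈ₛ lab v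
  ∈-ρ⁻ {u} {v} u∈ with i ∈? lab v
  ... | no _ = u , inj₁ refl , u∈
  ... | yes i∈ with x∈p∪q⁻ (lab v) _ u∈
  ...   | inj₁ u∈lab = u , inj₁ refl , u∈lab
  ...   | inj₂ u∈⁅j⁆ = i , inj₂ (x∈⁅y⁆⇒x≡y j u∈⁅j⁆ , refl) , i∈

  module _ {G : Graph n} where

    choices-ρ⁺ : ∀ {φ φ' : MG k} {ps : List (Path G)} →
      Pointwise (ChoiceOk lab) φ ps → Pointwise (Endwise (Repl i j)) φ φ' →
      Pointwise (ChoiceOk (ρ i j lab)) φ' ps
    choices-ρ⁺ []                      []                   = []
    choices-ρ⁺ ((a∈ , b∈) ∷ choices) ((a↦ , b↦) ∷ φ∼φ') =
      (∈-ρ⁺ a↦ a∈ , ∈-ρ⁺ b↦ b∈) ∷ choices-ρ⁺ choices φ∼φ'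

    choices-ρ⁻ : ∀ {φ : MG k} {ps : List (Path G)} → Pointwise (ChoiceOk (ρ i j lab)) φ ps →
      ∃ λ φ' → Pointwise (Endwise (Repl j i)) φ φ' × Pointwise (ChoiceOk lab) φ' ps
    choices-ρ⁻ [] = [] , [] , []
    choices-ρ⁻ ((a∈ , b∈) ∷ choices)
      with a' , a↦ , a'∈ ← ∈-ρ⁻ a∈
      with b' , b↦ , b'∈ ← ∈-ρ⁻ b∈
      with φ' , φ∼φ' , choices' ← choices-ρ⁻ choices
      = (a' , b') ∷ φ' , (a↦ , b↦) ∷ φ∼φ' , (a'∈ , b'∈) ∷ choices'

    aux-ρ⁺ : ∀ {A B} → AuxFam G lab A → InRepl i j A B → AuxFam G (ρ i j lab) B
    aux-ρ⁺ (ps , packing , φ , choices , φ≈A) A∼B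
      with φ' , φ∼φ' , φ'≈B ← ≈M-transport φ φ≈A A∼B
      = ps , packing , φ' , choices-ρ⁺ choices φ∼φ' , φ'≈B

    aux-ρ⁻ : ∀ {B} → AuxFam G (ρ i j lab) B → ∃ λ B' → InRepl j i B B' × AuxFam G lab B'
    aux-ρ⁻ {B} (ps , packing , φ , choices , φ≈B)
      with φ' , φ∼φ' , choices' ← choices-ρ⁻ choices
      with B' , B∼B' , B'≈φ' ← ≈M-transport B (λ a b → sym (φ≈B a b)) φ∼φ'
      = B' , B∼B' , ps , packing , φ' , choices' , λ a b → sym (B'≈φ' a b)

aux-resp-≈M : ∀ {n} {G : Graph n} {lab : Labeling n k} A B →
  A ≈M B → AuxFam G lab A → AuxFam G lab B
aux-resp-≈M A B A≈B (ps , packing , φ , choices , φ≈A) =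
  ps , packing , φ , choices , λ a b → trans (φ≈A a b) (A≈B a b)

-- Red-blue Eulerian trails

cast-↔ : ∀ {m n} → m ≡ n → Fin m ↔ Fin n
cast-↔ eq =
  mk↔ₛ′ (cast eq) (cast (sym eq)) (cast-involutive eq (sym eq)) (cast-involutive (sym eq) eq)

tailAlong headAlong : Bool → Edge k → Fin k
tailAlong false = proj₁
tailAlong true  = proj₂
headAlong false = proj₂
headAlong true  = proj₁

orient : Bool → Fin k → Fin k → Edge k
orient false x y = x , y
orient true  x y = y , x

tailAlong-orient : ∀ f (x y : Fin k) → tailAlong f (orient f x y) ≡ x
tailAlong-orient false x y = refl
tailAlong-orient true  x y = refl

headAlong-orient : ∀ f (x y : Fin k) → headAlong f (orient f x y) ≡ y
headAlong-orient false x y = refl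
headAlong-orient true  x y = refl

orient-Endwise : ∀ {_∼_ : Fin k → Fin k → Set} f {e x y} →
  tailAlong f e ∼ x → headAlong f e ∼ y → Endwise _∼_ e (orient f x y)
orient-Endwise false t∼x h∼y = t∼x , h∼y
orient-Endwise true  t∼x h∼y = h∼y , t∼x

tailOf-along : {R M : MG k} (s : Step R M) → tailOf s ≡ tailAlong (flipped s) (edgeOf s)
tailOf-along (step _ false) = refl
tailOf-along (step _ true)  = refl

headOf-along : {R M : MG k} (s : Step R M) → headOf s ≡ headAlong (flipped s) (edgeOf s)
headOf-along (step _ false) = refl
headOf-along (step _ true)  = refl

≢blue⇒red : ∀ {c} → c ≢ blue → c ≡ red
≢blue⇒red {red}  _    = refl
≢blue⇒red {blue} c≢c = contradiction refl c≢c

Ref : MG k → MG k → Set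
Ref R M = Fin (length R) ⊎ Fin (length M)

module _ {R M R' M' : MG k} (ι : Ref R M ↔ Ref R' M') where
  open Inverse ι

  retarget : Step R M → Step R' M'
  retarget (step r f) = step (to r) f

  retarget-trail : ∀ s ss → Linked (Next on retarget) (s ∷ ss ++ [ s ]) →
    Unique (map ref (s ∷ ss)) → (∀ r → r ∈ map ref (s ∷ ss)) → HasRBEulerianTrail R' M'
  retarget-trail s ss walk unique covers = map retarget (s ∷ ss) , walk' , unique' , covers'
    where
    refs : map ref (map retarget (s ∷ ss)) ≡ map to (map ref (s ∷ ss))
    refs = trans (sym (map-∘ (s ∷ ss))) (map-∘ (s ∷ ss))

    walk' : ClosedWalk (map retarget (s ∷ ss))
    walk' = subst (Linked Next ∘ (retarget s ∷_)) (map-++ retarget ss [ s ]) (Linked.map⁺ walk)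

    unique' : Unique (map ref (map retarget (s ∷ ss)))
    unique' = subst Unique (sym refs) (Unique.map⁺ (Injection.injective (↔⇒↣ ι)) unique)

    covers' : ∀ r → r ∈ map ref (map retarget (s ∷ ss))
    covers' r =
      subst (r ∈_) (sym refs) (subst (_∈ _) (strictlyInverseˡ r) (∈-map⁺ to (covers (from r))))

swapColours : {R M : MG k} → Step R M → Step M R
swapColours = retarget (⊎-comm _ _)

swapColours-head : {R M : MG k} (s : Step R M) → headOf (swapColours s) ≡ headOf s
swapColours-head (step (inj₁ _) false) = refl
swapColours-head (step (inj₁ _) true)  = refl
swapColours-head (step (inj₂ _) false) = refl
swapColours-head (step (inj₂ _) true)  = refl

swapColours-tail : {R M : MG k} (s : Step R M) → tailOf (swapColours s) ≡ tailOf s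
swapColours-tail (step (inj₁ _) false) = refl
swapColours-tail (step (inj₁ _) true)  = refl
swapColours-tail (step (inj₂ _) false) = refl
swapColours-tail (step (inj₂ _) true)  = refl

swapColours-next : {R M : MG k} {s t : Step R M} → Next s t → Next (swapColours s) (swapColours t)
swapColours-next {s = s} {t} (s→t , colours) =
  trans (swapColours-head s) (trans s→t (sym (swapColours-tail t))) , swapped s t colours
  where
  swapped : ∀ s t → colorOf s ≢ colorOf t → colorOf (swapColours s) ≢ colorOf (swapColours t)
  swapped (step (inj₁ _) _) (step (inj₂ _) _) _ = λ ()
  swapped (step (inj₂ _) _) (step (inj₁ _) _) _ = λ ()
  swapped (step (inj₁ _) _) (step (inj₁ _) _) c≢c = contradiction refl c≢c
  swapped (step (inj₂ _) _) (step (inj₂ _) _) c≢c = contradiction refl c≢c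

trail-swap : {R M : MG k} → HasRBEulerianTrail R M → HasRBEulerianTrail M R
trail-swap ([]     , ()   , _)
trail-swap (s ∷ ss , walk , unique , covers) =
  retarget-trail (⊎-comm _ _) s ss (Linked.map swapColours-next walk) unique covers

module Relabelling {_∼_ : Fin k → Fin k → Set} {R R' M : MG k} (R∼R' : Pointwise (Endwise _∼_) R R')
  (s : Step R M) (ss : List (Step R M)) (walk : ClosedWalk (s ∷ ss))
  (unique : Unique (map ref (s ∷ ss))) (covers : ∀ r → r ∈ map ref (s ∷ ss)) where

  steps : List (Step R M)
  steps = s ∷ ss

  pairs : List (Step R M × Step R M)
  pairs = consecutive s (ss ++ [ s ])

  pairs-next : ∀ {x y} → (x , y) ∈ pairs → Next x y
  pairs-next = All.lookup (Linked⇒All-consecutive walk)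

  map-proj₁-pairs : map proj₁ pairs ≡ steps
  map-proj₁-pairs = map-proj₁-consecutive s ss s

  map-proj₂-pairs : map proj₂ pairs ≡ ss ++ [ s ]
  map-proj₂-pairs = map-proj₂-consecutive s (ss ++ [ s ])

  fst∈steps : ∀ {x y} → (x , y) ∈ pairs → x ∈ steps
  fst∈steps xy = subst (_ ∈_) map-proj₁-pairs (∈-map⁺ proj₁ xy)

  snd∈steps : ∀ {x y} → (x , y) ∈ pairs → y ∈ steps
  snd∈steps xy = ∈-resp-↭ (↭-sym (∷↭∷ʳ s ss)) (subst (_ ∈_) map-proj₂-pairs (∈-map⁺ proj₂ xy))

  steps-injective : ∀ {x y} → x ∈ steps → y ∈ steps → ref x ≡ ref y → x ≡ y
  steps-injective = Unique-map⇒injective ref unique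

  predecessor-unique : ∀ {w w' x} → (w , x) ∈ pairs → (w' , x) ∈ pairs → w ≡ w'
  predecessor-unique wx w'x = cong proj₁ (Unique-map⇒injective (ref ∘ proj₂) unique₂ wx w'x refl)
    where
    unique₂ : Unique (map (ref ∘ proj₂) pairs)
    unique₂ = subst Unique (sym (trans (map-∘ pairs) (cong (map ref) map-proj₂-pairs)))
                (subst Unique (sym (map-++ ref ss [ s ])) (Unique-rotate (map ref ss) unique))

  successor-unique : ∀ {x y y'} → (x , y) ∈ pairs → (x , y') ∈ pairs → y ≡ y'
  successor-unique xy xy' = cong proj₂ (Unique-map⇒injective (ref ∘ proj₁) unique₁ xy xy' refl)
    where
    unique₁ : Unique (map (ref ∘ proj₁) pairs)
    unique₁ = subst Unique (sym (trans (map-∘ pairs) (cong (map ref) map-proj₁-pairs))) unique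

  step-at : ∀ r → ∃ λ x → x ∈ steps × ref x ≡ r
  step-at r with x , x∈ , r≡ ← ∈-map⁻ ref (covers r) = x , x∈ , sym r≡

  predecessor : ∀ {x} → x ∈ steps → ∃ λ w → (w , x) ∈ pairs
  predecessor x∈
    with (w , _) , wx , refl ←
           ∈-map⁻ proj₂ (subst (_ ∈_) (sym map-proj₂-pairs) (∈-resp-↭ (∷↭∷ʳ s ss) x∈))
    = w , wx

  successor : ∀ {x} → x ∈ steps → ∃ λ y → (x , y) ∈ pairs
  successor x∈
    with (_ , y) , xy , refl ← ∈-map⁻ proj₁ (subst (_ ∈_) (sym map-proj₁-pairs) x∈)
    = y , xy

  R'-edge : Fin (length R) → Edge k
  R'-edge e = lookup R' (cast (Pointwise-length R∼R') e)

  -- The values at blue steps are junk and never used: a blue step always sits between two red ones.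
  newTail newHead : Step R M → Fin k
  newTail (step (inj₁ e) f)   = tailAlong f (R'-edge e)
  newTail x@(step (inj₂ _) _) = tailOf x
  newHead (step (inj₁ e) f)   = headAlong f (R'-edge e)
  newHead x@(step (inj₂ _) _) = headOf x

  newTail-∼ : ∀ {x} → colorOf x ≡ red → tailOf x ∼ newTail x
  newTail-∼ {step (inj₁ e) false} _ = proj₁ (lookup⁺ R∼R' e)
  newTail-∼ {step (inj₁ e) true}  _ = proj₂ (lookup⁺ R∼R' e)

  newHead-∼ : ∀ {x} → colorOf x ≡ red → headOf x ∼ newHead x
  newHead-∼ {step (inj₁ e) false} _ = proj₂ (lookup⁺ R∼R' e)
  newHead-∼ {step (inj₁ e) true}  _ = proj₁ (lookup⁺ R∼R' e)

  reattached : ∀ {x} → x ∈ steps → Edge k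
  reattached {x} x∈ =
    orient (flipped x) (newHead (proj₁ (predecessor x∈))) (newTail (proj₁ (successor x∈)))

  reattached-unique : ∀ {x y w u} (x∈ : x ∈ steps) → ref x ≡ ref y →
    (w , y) ∈ pairs → (y , u) ∈ pairs → reattached x∈ ≡ orient (flipped y) (newHead w) (newTail u)
  reattached-unique x∈ x≈y wy yu with refl ← steps-injective x∈ (snd∈steps wy) x≈y =
    cong₂ (λ w u → orient _ (newHead w) (newTail u))
      (predecessor-unique (proj₂ (predecessor x∈)) wy)
      (successor-unique (proj₂ (successor x∈)) yu)

  reattached-∼ : ∀ {x e} (x∈ : x ∈ steps) → ref x ≡ inj₂ e →
    Endwise _∼_ (lookup M e) (reattached x∈)
  reattached-∼ x@{step _ f} {e} x∈ refl = orient-Endwise {_∼_ = _∼_} f tail∼ head∼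
    where
    w = proj₁ (predecessor x∈)
    u = proj₁ (successor x∈)
    wx = proj₂ (predecessor x∈)
    xu = proj₂ (successor x∈)

    tail∼ : tailAlong f (lookup M e) ∼ newHead w
    tail∼ = subst (_∼ newHead w) (trans (proj₁ (pairs-next wx)) (tailOf-along x))
              (newHead-∼ {w} (≢blue⇒red (proj₂ (pairs-next wx))))

    head∼ : headAlong f (lookup M e) ∼ newTail u
    head∼ = subst (_∼ newTail u) (trans (sym (proj₁ (pairs-next xu))) (headOf-along x))
              (newTail-∼ {u} (≢blue⇒red (proj₂ (pairs-next xu) ∘ sym)))

  M'-edge : Fin (length M) → Edge k
  M'-edge e = reattached (proj₁ (proj₂ (step-at (inj₂ e))))

  M' : MG k
  M' = tabulate M'-edge

  M∼M' : Pointwise (Endwise _∼_) M M'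
  M∼M' = subst (λ xs → Pointwise (Endwise _∼_) xs M') (tabulate-lookup M)
    (tabulate⁺ λ e → let _ , x∈ , x≈e = step-at (inj₂ e) in reattached-∼ x∈ x≈e)

  M'-edge-at : ∀ {w y u e} → (w , y) ∈ pairs → (y , u) ∈ pairs → ref y ≡ inj₂ e →
    M'-edge e ≡ orient (flipped y) (newHead w) (newTail u)
  M'-edge-at {e = e} wy yu y≈e =
    let _ , x∈ , x≈e = step-at (inj₂ e) in reattached-unique x∈ (trans x≈e (sym y≈e)) wy yu

  refs↔ : Ref R M ↔ Ref R' M'
  refs↔ = cast-↔ (Pointwise-length R∼R') ⊎-↔ cast-↔ (sym (length-tabulate M'-edge))

  new : Step R M → Step R' M'
  new = retarget refs↔

  new-red-ends : ∀ e f → let x = step (inj₁ e) f in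
    tailOf (new x) ≡ newTail x × headOf (new x) ≡ newHead x
  new-red-ends e false = refl , refl
  new-red-ends e true  = refl , refl

  new-blue-ends : ∀ {w u e f} → let y = step (inj₂ e) f in (w , y) ∈ pairs → (y , u) ∈ pairs →
    tailOf (new y) ≡ newHead w × headOf (new y) ≡ newTail u
  new-blue-ends {w} {u} {e} {f} wy yu =
    trans (tailOf-along (new y)) (trans (cong (tailAlong f) edge) (tailAlong-orient f _ _)) ,
    trans (headOf-along (new y)) (trans (cong (headAlong f) edge) (headAlong-orient f _ _))
    where
    y = step (inj₂ e) f
    edge : edgeOf (new y) ≡ orient f (newHead w) (newTail u)
    edge = trans (lookup-tabulate M'-edge e) (M'-edge-at wy yu refl)

  new-next : ∀ {x y} → (x , y) ∈ pairs → Next (new x) (new y)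
  new-next {step (inj₁ e) f} {step (inj₂ _) _} xy =
    trans (proj₂ (new-red-ends e f)) (sym (proj₁ (new-blue-ends xy yu))) , λ ()
    where yu = proj₂ (successor (snd∈steps xy))
  new-next {step (inj₂ _) _} {step (inj₁ e) f} xy =
    trans (proj₂ (new-blue-ends wx xy)) (sym (proj₁ (new-red-ends e f))) , λ ()
    where wx = proj₂ (predecessor (fst∈steps xy))
  new-next {step (inj₁ _) _} {step (inj₁ _) _} xy = contradiction refl (proj₂ (pairs-next xy))
  new-next {step (inj₂ _) _} {step (inj₂ _) _} xy = contradiction refl (proj₂ (pairs-next xy))

  trail : HasRBEulerianTrail R' M'
  trail = retarget-trail refs↔ s ss
    (All-consecutive⇒Linked (ss ++ [ s ]) (All.tabulate new-next)) unique covers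

trail-relabel : ∀ {_∼_ : Fin k → Fin k → Set} {R R' M : MG k} → Pointwise (Endwise _∼_) R R' →
  HasRBEulerianTrail R M → ∃ λ M' → Pointwise (Endwise _∼_) M M' × HasRBEulerianTrail R' M'
trail-relabel R∼R' ([]     , ()   , _)
trail-relabel R∼R' (s ∷ ss , walk , unique , covers) = M' , M∼M' , trail
  where open Relabelling R∼R' s ss walk unique covers

Repl-flip : ∀ {i j u u' : Fin k} → Repl j i u u' → Repl i j u' u
Repl-flip (inj₁ refl)          = inj₁ refl
Repl-flip (inj₂ (u≡j , u'≡i)) = inj₂ (u'≡i , u≡j)

mainTheorem7 : ∀ {n k} (G : Graph n) (laby : Labeling n k) (i j : Fin k) → i ≢ j →
    (Ay : Fam k) → Ay ⊆F AuxFam G laby → Ay ≲ AuxFam G laby →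
    (liftFam i j Ay ⊆F AuxFam G (ρ i j laby)) × (liftFam i j Ay ≲ AuxFam G (ρ i j laby))
mainTheorem7 G laby i j _ Ay Ay⊆aux Ay≲aux = lift⊆aux , lift≲aux
  where
  lift⊆aux : liftFam i j Ay ⊆F AuxFam G (ρ i j laby)
  lift⊆aux B (A , A∈Ay , B' , A∼B' , B'≈B) = aux-resp-≈M B' B B'≈B (aux-ρ⁺ (Ay⊆aux A A∈Ay) A∼B')

  lift≲aux : liftFam i j Ay ≲ AuxFam G (ρ i j laby)
  lift≲aux M (B , B∈aux , B+M) =
    let By , B∼By , By∈aux = aux-ρ⁻ B∈aux
        My , M∼My , By+My  = trail-relabel B∼By B+M
        A , A∈Ay , A+My    = Ay≲aux My (By , By∈aux , By+My)
        My∼M               = symmetric (Product.map Repl-flip Repl-flip) M∼My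
        A' , A∼A' , M+A'   = trail-relabel My∼M (trail-swap A+My)
    in  A' , (A , A∈Ay , A' , A∼A' , λ _ _ → refl) , trail-swap M+A'
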